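{- Let $\mathcal{F}\subseteq\mathcal{S}$ be a family of Catalan--Stanley trees with bivariate generating function $f(z,t)$, where $t$ marks the rightmost leaves of the branches attached to the root and $z$ marks all other nodes. Then the generating function (in the same sense) of $\rho^{ -1}(\mathcal{F})=\{\tau\in\mathcal{S} : \rho(\tau)\in\mathcal{F}\}$ is \[ \Phi(f(z,t)) = \frac{1}{1-t}\, f\Big(z, \frac{t}{1-t}\,T(z)^{2}\Big), \] where $T(z)=\frac{1-\sqrt{1-4z}}{2}$.
   Context: A rooted plane tree has ordered children at every node. For each child $c$ of the root, the rightmost leaf of the branch at $c$ is the leaf reached from $c$ by repeatedly moving to the rightmost child. A Catalan--Stanley tree is a rooted plane tree in which every such rightmost leaf has odd distance to the root (the one-node tree is included); $\mathcal{S}$ is the class of these trees. The reduction $\rho:\mathcal{S}\to\mathcal{S}$ acts on a tree $\tau$ as follows: for each rightmost leaf $\ell$ of a branch attached to the root, if $\ell$ is a child of the root then $\ell$ is deleted; otherwise all descendants of the grandparent $g$ of $\ell$ are deleted, so that $g$ becomes a leaf (and is now the rightmost leaf of its branch). The one-node tree is mapped to itself. The bivariate generating function of a family $\mathcal{F}\subseteq\mathcal{S}$ is $\sum_{\tau\in\mathcal{F}} z^{a(\tau)}t^{b(\tau)}$, where $b(\tau)$ is the number of rightmost leaves of branches attached to the root (= number of children of the root) and $a(\tau)$ is the number of remaining nodes. $T(z)$ is the generating function of rooted plane trees by number of nodes, satisfying $T=z+T^2$. -}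

module Defs where

open import Data.Nat using (ℕ; zero; suc; _+_; _*_; _∸_; _/_)
open import Data.Nat.Combinatorics using (_C_)
open import Data.List using (List; []; _∷_; length)
open import Data.List.Relation.Unary.All using (All)
open import Data.List.Relation.Unary.Unique.Propositional using (Unique)
open import Data.List.Membership.Propositional using (_∈_)
open import Data.Product using (Σ; _×_)
open import Function.Bundles using (_⇔_)
open import Relation.Binary.PropositionalEquality using (_≡_)

data Tree : Set where
  node : List Tree → Tree

data Odd : ℕ → Set where
  odd-one : Odd 1
  odd-ss  : ∀ {n} → Odd n → Odd (suc (suc n))

mutual
  -- distance from a node to the leaf reached by repeatedly moving to the
  -- rightmost child
  rdepth : Tree → ℕ
  rdepth (node cs) = rdepthL cs

  rdepthL : List Tree → ℕ
  rdepthL [] = 0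
  rdepthL (c ∷ []) = suc (rdepth c)
  rdepthL (c ∷ d ∷ cs) = rdepthL (d ∷ cs)

-- Catalan--Stanley trees: for every child c of the root, the rightmost leaf
-- of the branch at c has odd distance (= 1 + rdepth c) to the root.
IsCS : Tree → Set
IsCS (node cs) = All (λ c → Odd (suc (rdepth c))) cs

isLeaf : Tree → Set
isLeaf t = rdepth t ≡ 0

mutual
  -- cut t : follow the rightmost path from t to the node g having rdepth 2
  -- (the grandparent of the rightmost leaf) and delete all descendants of g.
  cut : Tree → Tree
  cut (node cs) = node (cutNode (rdepthL cs) cs)

  cutNode : ℕ → List Tree → List Tree
  cutNode 2 cs = []
  cutNode _ cs = cutL cs

  cutL : List Tree → List Tree
  cutL [] = []
  cutL (c ∷ []) = cut c ∷ []
  cutL (c ∷ d ∷ cs) = c ∷ cutL (d ∷ cs)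

-- processing one branch of the root: leaf children of the root are deleted,
-- otherwise the branch is cut at the grandparent of its rightmost leaf.
rhoBranch : ℕ → Tree → List Tree → List Tree
rhoBranch zero    c rest = rest
rhoBranch (suc _) c rest = cut c ∷ rest

rhoL : List Tree → List Tree
rhoL [] = []
rhoL (c ∷ cs) = rhoBranch (rdepth c) c (rhoL cs)

ρ : Tree → Tree
ρ (node cs) = node (rhoL cs)

mutual
  size : Tree → ℕ
  size (node cs) = suc (sizeL cs)

  sizeL : List Tree → ℕ
  sizeL [] = 0
  sizeL (c ∷ cs) = size c + sizeL cs

-- b τ : number of rightmost leaves of branches at the root = number of
--       children of the root
b : Tree → ℕ
b (node cs) = length cs

-- a τ : number of remaining nodes
a : Tree → ℕ
a τ = size τ ∸ b τ

HasCount : (Tree → Set) → ℕ → Set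
HasCount Q c = Σ (List Tree) λ xs →
  Unique xs × (∀ τ → (τ ∈ xs) ⇔ Q τ) × length xs ≡ c

-- Bivariate formal power series in z, t with ℕ coefficients:
-- s n k = [z^n t^k] s

Series2 : Set
Series2 = ℕ → ℕ → ℕ

sum≤ : ℕ → (ℕ → ℕ) → ℕ
sum≤ zero    f = f 0
sum≤ (suc n) f = sum≤ n f + f (suc n)

_⊛_ : Series2 → Series2 → Series2
(f ⊛ g) n k = sum≤ n λ i → sum≤ k λ j → f i j * g (n ∸ i) (k ∸ j)

one : Series2
one zero zero = 1
one _    _    = 0

pow : Series2 → ℕ → Series2
pow u zero    = one
pow u (suc j) = u ⊛ pow u j

tSer : Series2
tSer zero (suc zero) = 1
tSer _    _          = 0

geom : Series2
geom zero k = 1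
geom (suc _) k = 0

catalan : ℕ → ℕ
catalan n = ((2 * n) C n) / suc n

-- T(z) = (1 - √(1-4z))/2 = Σ_{n≥0} catalan n · z^{n+1}, the power series
-- solution of T = z + T² with T(0) = 0, seen as a series in z, t
Tser : Series2
Tser (suc n) zero = catalan n
Tser _       _    = 0

-- substitution f(z, u(z,t)) for u with no t^0 terms (u(z,0) = 0), so that
-- [t^k] u^j = 0 for j > k and the coefficient sums are finite:
-- [z^n t^k] f(z,u) = Σ_{m≤n} Σ_{j≤k} f_{m,j} [z^{n-m} t^k] u^j
substT : Series2 → Series2 → Series2
substT f u n k = sum≤ n λ m → sum≤ k λ j → f m j * pow u j (n ∸ m) k

uSer : Series2
uSer = ((tSer ⊛ geom) ⊛ Tser) ⊛ Tser

Φ : Series2 → Series2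
Φ f = geom ⊛ substT f uSer

module Submission where

-- The generating function of ρ⁻¹(F) is obtained from a weight-preserving
-- bijection.  A Catalan--Stanley tree τ is determined by its reduction
-- σ = ρ τ together with a skeleton: the number j of leaf children of the
-- root before the first non-leaf branch and, for every child of σ, a block
-- (r , x , y) made of the trees x, y whose nodes ρ deleted from that branch
-- and the number r of leaf children of the root following the branch.
-- Leading leaves give 1/(1-t); a block gives t · 1/(1-t) · T(z)², and the
-- blocks replace the marked rightmost leaves (the t's) of σ, hence Φ f.

open import Defs
open import Data.Nat using (ℕ; zero; suc; _+_; _*_; _∸_; _/_; _≤_; z≤n; s≤s)
open import Data.Nat.Properties
open import Data.Nat.Combinatorics using (_C_; nCk≡nC[n∸k]; nCn≡1; nC1≡n; nCk+nC[k+1]≡[n+1]C[k+1])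
open import Data.Nat.Combinatorics.Specification using (k>n⇒nCk≡0)
open import Data.Nat.DivMod using (m*n/n≡m)
open import Data.Nat.Tactic.RingSolver using (solve-∀)
open import Data.List
  using (List; []; _∷_; length; map; replicate; _++_; _∷ʳ_; cartesianProduct; _∷ʳ′_; initLast)
open import Data.Nat.ListAction using (sum)
open import Data.List.Properties using (length-map; length-++; length-replicate)
open import Data.List.Relation.Unary.All using (All; []; _∷_; universal)
open import Data.List.Relation.Unary.All.Properties using (++⁺)
open import Data.List.Relation.Unary.Any using (here; there)
open import Data.List.Relation.Unary.AllPairs using ([]; _∷_)
open import Data.List.Relation.Unary.Unique.Propositional using (Unique)
import Data.List.Relation.Unary.Unique.Propositional.Properties as Unique
open import Data.List.Membership.Propositional using (_∈_)
open import Data.List.Membership.Propositional.Properties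
  using (∈-map⁺; ∈-map⁻; ∈-++⁺ˡ; ∈-++⁺ʳ; ∈-++⁻; ∈-cartesianProduct⁺; ∈-cartesianProduct⁻)
open import Data.Product using (Σ; _×_; _,_; proj₁; proj₂; map₁)
open import Data.Sum using (_⊎_; inj₁; inj₂)
open import Data.Empty using (⊥; ⊥-elim)
open import Data.Unit using (⊤; tt)
open import Function using (_∘_)
open import Function.Bundles using (_⇔_; mk⇔; Equivalence)
open import Relation.Nullary using (¬_; contradiction)
open import Relation.Binary.PropositionalEquality

open Equivalence using (to; from)

Count : {A : Set} → (A → Set) → ℕ → Set
Count {A} P c = Σ (List A) λ xs → Unique xs × (∀ x → (x ∈ xs) ⇔ P x) × length xs ≡ c

module _ {A : Set} where

  count-resp : {P Q : A → Set} {c : ℕ} → (∀ x → P x → Q x) → (∀ x → Q x → P x)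
    → Count P c → Count Q c
  count-resp pq qp (xs , u , mem , len) =
    xs , u , (λ x → mk⇔ (pq x ∘ to (mem x)) (from (mem x) ∘ qp x)) , len

  count-≡ : {P : A → Set} {c d : ℕ} → c ≡ d → Count P c → Count P d
  count-≡ refl cnt = cnt

  count-none : {P : A → Set} → (∀ x → ¬ P x) → Count P 0
  count-none ¬p = [] , [] , (λ x → mk⇔ (λ ()) (⊥-elim ∘ ¬p x)) , refl

  count-single : {P : A → Set} (x₀ : A) → P x₀ → (∀ x → P x → x ≡ x₀) → Count P 1
  count-single x₀ px₀ unique =
    x₀ ∷ [] , [] ∷ [] , (λ x → mk⇔ (λ { (here refl) → px₀ }) (here ∘ unique x)) , refl

  count-⊎ : {P Q : A → Set} {c d : ℕ} → (∀ x → P x → ¬ Q x)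
    → Count P c → Count Q d → Count (λ x → P x ⊎ Q x) (c + d)
  count-⊎ {P} {Q} disjoint (xs , u , mem , len) (ys , v , mem′ , len′) =
    xs ++ ys , Unique.++⁺ u v apart , (λ x → mk⇔ (inside x ∘ ∈-++⁻ xs) (enlist x)) ,
    trans (length-++ xs) (cong₂ _+_ len len′)
    where
    apart : ∀ {x} → ¬ (x ∈ xs × x ∈ ys)
    apart {x} (i , j) = disjoint x (to (mem x) i) (to (mem′ x) j)
    inside : ∀ x → x ∈ xs ⊎ x ∈ ys → P x ⊎ Q x
    inside x (inj₁ i) = inj₁ (to (mem x) i)
    inside x (inj₂ j) = inj₂ (to (mem′ x) j)
    enlist : ∀ x → P x ⊎ Q x → x ∈ xs ++ ys
    enlist x (inj₁ p) = ∈-++⁺ˡ (from (mem x) p)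
    enlist x (inj₂ q) = ∈-++⁺ʳ xs (from (mem′ x) q)

  count-sum : {P : A → Set} (stat : A → ℕ) (n : ℕ) (c : ℕ → ℕ)
    → (∀ x → P x → stat x ≤ n)
    → (∀ i → i ≤ n → Count (λ x → P x × stat x ≡ i) (c i))
    → Count P (sum≤ n c)
  count-sum stat zero c bounded fibre =
    count-resp (λ _ → proj₁) (λ x p → p , n≤0⇒n≡0 (bounded x p)) (fibre 0 z≤n)
  count-sum {P} stat (suc n) c bounded fibre =
    count-resp (λ _ → merge) split (count-⊎ disjoint below (fibre (suc n) ≤-refl))
    where
    below : Count (λ x → P x × stat x ≤ n) (sum≤ n c)
    below = count-sum stat n c (λ _ → proj₂) λ i i≤n →
      count-resp (λ x (p , e) → (p , subst (_≤ n) (sym e) i≤n) , e) (λ x ((p , _) , e) → p , e)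
        (fibre i (m≤n⇒m≤1+n i≤n))
    disjoint : ∀ x → P x × stat x ≤ n → ¬ (P x × stat x ≡ suc n)
    disjoint x (_ , le) (_ , e) = <⇒≢ (s≤s le) e
    merge : ∀ {x} → (P x × stat x ≤ n) ⊎ (P x × stat x ≡ suc n) → P x
    merge (inj₁ (p , _)) = p
    merge (inj₂ (p , _)) = p
    split : ∀ x → P x → (P x × stat x ≤ n) ⊎ (P x × stat x ≡ suc n)
    split x p with m≤n⇒m<n∨m≡n (bounded x p)
    ... | inj₁ (s≤s le) = inj₁ (p , le)
    ... | inj₂ e        = inj₂ (p , e)

length-cartesianProduct : {A B : Set} (xs : List A) (ys : List B)
  → length (cartesianProduct xs ys) ≡ length xs * length ys
length-cartesianProduct []       ys = refl
length-cartesianProduct (x ∷ xs) ys = begin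
  length (map (x ,_) ys ++ cartesianProduct xs ys)
    ≡⟨ length-++ (map (x ,_) ys) ⟩
  length (map (x ,_) ys) + length (cartesianProduct xs ys)
    ≡⟨ cong₂ _+_ (length-map (x ,_) ys) (length-cartesianProduct xs ys) ⟩
  length ys + length xs * length ys ∎
  where open ≡-Reasoning

count-× : {A B : Set} {P : A → Set} {Q : B → Set} {c d : ℕ}
  → Count P c → Count Q d → Count (λ (x , y) → P x × Q y) (c * d)
count-× (xs , u , mem , len) (ys , v , mem′ , len′) =
  cartesianProduct xs ys , Unique.cartesianProduct⁺ u v ,
  (λ (x , y) → mk⇔ (λ i → let (i₁ , i₂) = ∈-cartesianProduct⁻ xs ys i in to (mem x) i₁ , to (mem′ y) i₂)
                   (λ (p , q) → ∈-cartesianProduct⁺ (from (mem x) p) (from (mem′ y) q))) ,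
  trans (length-cartesianProduct xs ys) (cong₂ _*_ len len′)

unique-map : {A B : Set} (g : A → B) (xs : List A)
  → (∀ {x y} → x ∈ xs → y ∈ xs → g x ≡ g y → x ≡ y) → Unique xs → Unique (map g xs)
unique-map g []       inj []         = []
unique-map g (x ∷ xs) inj (x∉ ∷ u) =
  images xs x∉ (λ y∈ → inj (here refl) (there y∈)) ∷ unique-map g xs (λ i j → inj (there i) (there j)) u
  where
  images : ∀ ys → All (λ y → ¬ x ≡ y) ys → (∀ {y} → y ∈ ys → g x ≡ g y → x ≡ y)
    → All (λ z → ¬ g x ≡ z) (map g ys)
  images []       []          _   = []
  images (y ∷ ys) (x≢y ∷ x∉) inj′ = (x≢y ∘ inj′ (here refl)) ∷ images ys x∉ (inj′ ∘ there)

count-bij : {A B : Set} {P : A → Set} {Q : B → Set} {c : ℕ} (g : A → B)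
  → (∀ x → P x → Q (g x))
  → (∀ x y → P x → P y → g x ≡ g y → x ≡ y)
  → (∀ y → Q y → Σ A λ x → P x × g x ≡ y)
  → Count P c → Count Q c
count-bij {Q = Q} g into inj onto (xs , u , mem , len) =
  map g xs ,
  unique-map g xs (λ {x} {y} i j → inj x y (to (mem x) i) (to (mem y) j)) u ,
  (λ y → mk⇔ (λ i → let (x , j , e) = ∈-map⁻ g i in subst Q (sym e) (into x (to (mem x) j)))
              (λ q → let (x , px , e) = onto y q in subst (_∈ map g xs) e (∈-map⁺ g (from (mem x) px)))) ,
  trans (length-map g xs) len

-- A class P of objects with a z-weight and a t-weight has bivariate
-- generating function s.  The hypothesis of the main theorem says exactly
-- `Counted F a b f`.
Counted : {A : Set} → (A → Set) → (A → ℕ) → (A → ℕ) → Series2 → Set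
Counted P wz wt s = ∀ n k → Count (λ x → P x × wz x ≡ n × wt x ≡ k) (s n k)

part-≤ : ∀ {m m′ N} → m + m′ ≡ N → m ≤ N
part-≤ {m} {m′} refl = m≤m+n m m′

split-weight : ∀ {m m′ N} → m + m′ ≡ N → m′ ≡ N ∸ m
split-weight {m} {m′} refl = sym (m+n∸m≡n m m′)

join-weight : ∀ {m m′ N} → m ≤ N → m′ ≡ N ∸ m → m + m′ ≡ N
join-weight m≤N refl = m+[n∸m]≡n m≤N

counted-⊛ : {A B : Set} {P : A → Set} {Q : B → Set} {wz wt : A → ℕ} {vz vt : B → ℕ} {p q : Series2}
  → Counted P wz wt p → Counted Q vz vt q
  → Counted (λ (x , y) → P x × Q y) (λ (x , y) → wz x + vz y) (λ (x , y) → wt x + vt y) (p ⊛ q)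
counted-⊛ {wz = wz} {wt} cp cq n k =
  count-sum (wz ∘ proj₁) n _ (λ _ (_ , ez , _) → part-≤ ez) λ i i≤n →
  count-sum (wt ∘ proj₁) k _ (λ _ ((_ , _ , et) , _) → part-≤ et) λ j j≤k →
  count-resp
    (λ { _ ((px , refl , refl) , (qy , ez , et)) →
         (((px , qy) , join-weight i≤n ez , join-weight j≤k et) , refl) , refl })
    (λ { _ ((((px , qy) , ez , et) , refl) , refl) →
         (px , refl , refl) , (qy , split-weight ez , split-weight et) })
    (count-× (cp i j) (cq (n ∸ i) (k ∸ j)))

counted-pow : {A : Set} {P : A → Set} {wz wt : A → ℕ} {u : Series2} → Counted P wz wt u
  → ∀ j → Counted (λ l → All P l × length l ≡ j) (sum ∘ map wz) (sum ∘ map wt) (pow u j)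
counted-pow cu zero zero    zero    =
  count-single [] (([] , refl) , refl , refl) λ { [] _ → refl ; (_ ∷ _) ((_ , ()) , _) }
counted-pow cu zero zero    (suc k) = count-none λ { [] (_ , _ , ()) ; (_ ∷ _) ((_ , ()) , _) }
counted-pow cu zero (suc n) k       = count-none λ { [] (_ , () , _) ; (_ ∷ _) ((_ , ()) , _) }
counted-pow cu (suc j) n k =
  count-bij (λ (x , l) → x ∷ l)
    (λ { (x , l) ((px , pl , refl) , ez , et) → ((px ∷ pl) , refl) , ez , et })
    (λ { _ _ _ _ refl → refl })
    (λ { (x ∷ l) (((px ∷ pl) , e) , ez , et) → (x , l) , ((px , pl , suc-injective e) , ez , et) , refl
       ; [] ((_ , ()) , _) })
    (counted-⊛ cu (counted-pow cu j) n k)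

counted-substT : {A B : Set} {F : B → Set} {a′ b′ : B → ℕ} {P : A → Set} {wz wt : A → ℕ} {f u : Series2}
  → Counted F a′ b′ f → Counted P wz wt u → (∀ x → P x → 1 ≤ wt x)
  → Counted (λ (σ , l) → F σ × All P l × length l ≡ b′ σ)
            (λ (σ , l) → a′ σ + sum (map wz l)) (λ (σ , l) → sum (map wt l)) (substT f u)
counted-substT {a′ = a′} {b′} {P} {wt = wt} cf cu positive n k =
  count-sum (a′ ∘ proj₁) n _ (λ _ (_ , ez , _) → part-≤ ez) λ m m≤n →
  count-sum (b′ ∘ proj₁) k _
    (λ { (_ , l) (((_ , pl , len) , _ , et) , _) → subst₂ _≤_ len et (length≤weight l pl) }) λ j j≤k →
  count-resp
    (λ { _ ((fσ , refl , refl) , ((pl , len) , ez , et)) →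
         (((fσ , pl , len) , join-weight m≤n ez , et) , refl) , refl })
    (λ { _ ((((fσ , pl , len) , ez , et) , refl) , refl) →
         (fσ , refl , refl) , ((pl , len) , split-weight ez , et) })
    (count-× (cf m j) (counted-pow cu j (n ∸ m) k))
  where
  length≤weight : ∀ l → All P l → length l ≤ sum (map wt l)
  length≤weight []      []         = z≤n
  length≤weight (x ∷ l) (px ∷ pl) = +-mono-≤ (positive x px) (length≤weight l pl)

counted-geom : Counted {ℕ} (λ _ → ⊤) (λ _ → 0) (λ r → r) geom
counted-geom zero    k = count-single k (tt , refl , refl) λ _ (_ , _ , e) → e
counted-geom (suc n) k = count-none λ { _ (_ , () , _) }

counted-t : Counted {⊤} (λ _ → ⊤) (λ _ → 0) (λ _ → 1) tSer
counted-t zero    (suc zero)    = count-single tt (tt , refl , refl) λ _ _ → refl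
counted-t zero    zero          = count-none λ { _ (_ , _ , ()) }
counted-t zero    (suc (suc k)) = count-none λ { _ (_ , _ , ()) }
counted-t (suc n) k             = count-none λ { _ (_ , () , _) }

counted-resp : {A : Set} {P Q : A → Set} {wz wz′ wt wt′ : A → ℕ} {s : Series2}
  → (∀ x → P x → Q x) → (∀ x → Q x → P x) → (∀ x → wz x ≡ wz′ x) → (∀ x → wt x ≡ wt′ x)
  → Counted P wz wt s → Counted Q wz′ wt′ s
counted-resp pq qp ez et cp n k = count-resp
  (λ x (p , e₁ , e₂) → pq x p , trans (sym (ez x)) e₁ , trans (sym (et x)) e₂)
  (λ x (q , e₁ , e₂) → qp x q , trans (ez x) e₁ , trans (et x) e₂)
  (cp n k)

counted-bij : {A B : Set} {P : A → Set} {Q : B → Set} {wz wt : A → ℕ} {vz vt : B → ℕ} {s : Series2}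
  (g : A → B)
  → (∀ x → P x → Q (g x) × vz (g x) ≡ wz x × vt (g x) ≡ wt x)
  → (∀ x y → P x → P y → g x ≡ g y → x ≡ y)
  → (∀ y → Q y → Σ A λ x → P x × g x ≡ y)
  → Counted P wz wt s → Counted Q vz vt s
counted-bij {A} {P = P} {Q} {wz} {wt} {vz} {vt} g into inj onto cp n k =
  count-bij g
    (λ x (p , ez , et) → let (q , e₁ , e₂) = into x p in q , trans e₁ ez , trans e₂ et)
    (λ x y (p , _) (p′ , _) → inj x y p p′)
    onto′
    (cp n k)
  where
  onto′ : ∀ y → Q y × vz y ≡ n × vt y ≡ k → Σ A λ x → (P x × wz x ≡ n × wt x ≡ k) × g x ≡ y
  onto′ y (q , ez , et) with onto y q
  ... | x , p , refl = let (_ , e₁ , e₂) = into x p in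
                        x , (p , trans (sym e₁) ez , trans (sym e₂) et) , refl

-- The ballot numbers: `ballot r e` counts plane forests of r trees with
-- r + e nodes (see `counted-forests`).  The recursion removes the first
-- tree when it is a leaf, and otherwise splits its first subtree off.
ballot : ℕ → ℕ → ℕ
ballot r       zero    = 1
ballot zero    (suc e) = 0
ballot (suc r) (suc e) = ballot r (suc e) + ballot (suc (suc r)) e

-- C(m, e - 1), with the convention C(m, -1) = 0.
choosePrev : ℕ → ℕ → ℕ
choosePrev m zero    = 0
choosePrev m (suc e) = m C e

nC0≡1 : ∀ n → n C 0 ≡ 1
nC0≡1 n = trans (nCk≡nC[n∸k] {0} {n} z≤n) (nCn≡1 n)

pascal : ∀ n k → suc n C suc k ≡ n C k + n C suc k
pascal n k = sym (nCk+nC[k+1]≡[n+1]C[k+1] n k)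

pascal-prev : ∀ m e → suc m C e ≡ choosePrev m e + m C e
pascal-prev m zero    = trans (nC0≡1 (suc m)) (sym (nC0≡1 m))
pascal-prev m (suc e) = pascal m e

absorption : ∀ m k → suc k * (suc m C suc k) ≡ suc m * (m C k)
absorption m zero = begin
  1 * (suc m C 1)   ≡⟨ *-identityˡ _ ⟩
  suc m C 1         ≡⟨ nC1≡n (suc m) ⟩
  suc m             ≡⟨ *-identityʳ (suc m) ⟨
  suc m * 1         ≡⟨ cong (suc m *_) (nC0≡1 m) ⟨
  suc m * (m C 0)   ∎
  where open ≡-Reasoning
absorption zero (suc k) = begin
  suc (suc k) * (1 C suc (suc k)) ≡⟨ cong (suc (suc k) *_) (k>n⇒nCk≡0 {1} {suc (suc k)} (s≤s (s≤s z≤n))) ⟩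
  suc (suc k) * 0                 ≡⟨ *-zeroʳ (suc (suc k)) ⟩
  0                               ≡⟨ k>n⇒nCk≡0 {0} {suc k} (s≤s z≤n) ⟨
  0 C suc k                       ≡⟨ *-identityˡ _ ⟨
  1 * (0 C suc k)                 ∎
  where open ≡-Reasoning
absorption (suc m) (suc k) = begin
  suc (suc k) * (suc (suc m) C suc (suc k))  ≡⟨ cong (suc (suc k) *_) (pascal (suc m) (suc k)) ⟩
  suc (suc k) * (X + Y)                      ≡⟨ *-distribˡ-+ (suc (suc k)) X Y ⟩
  (X + suc k * X) + suc (suc k) * Y
    ≡⟨ cong₂ (λ p q → (X + p) + q) (absorption m k) (absorption m (suc k)) ⟩
  (X + suc m * U) + suc m * V                ≡⟨ +-assoc X (suc m * U) (suc m * V) ⟩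
  X + (suc m * U + suc m * V)                ≡⟨ cong (X +_) (*-distribˡ-+ (suc m) U V) ⟨
  X + suc m * (U + V)                        ≡⟨ cong (λ p → X + suc m * p) (pascal m k) ⟨
  X + suc m * X                              ∎
  where
  open ≡-Reasoning
  X = suc m C suc k
  Y = suc m C suc (suc k)
  U = m C k
  V = m C suc k

absorption-sym : ∀ m k → k ≤ m → (suc m ∸ k) * (suc m C k) ≡ suc m * (m C k)
absorption-sym m k k≤m = begin
  (suc m ∸ k) * (suc m C k)            ≡⟨ cong ((suc m ∸ k) *_) (nCk≡nC[n∸k] (m≤n⇒m≤1+n k≤m)) ⟩
  (suc m ∸ k) * (suc m C (suc m ∸ k))  ≡⟨ cong (λ p → p * (suc m C p)) (+-∸-assoc 1 k≤m) ⟩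
  suc (m ∸ k) * (suc m C suc (m ∸ k))  ≡⟨ absorption m (m ∸ k) ⟩
  suc m * (m C (m ∸ k))                ≡⟨ cong (suc m *_) (nCk≡nC[n∸k] k≤m) ⟨
  suc m * (m C k)                      ∎
  where open ≡-Reasoning

central-sym : ∀ e → (e + suc e) C e ≡ (e + suc e) C suc e
central-sym e = begin
  (e + suc e) C e                  ≡⟨ nCk≡nC[n∸k] (m≤m+n e (suc e)) ⟩
  (e + suc e) C (e + suc e ∸ e)    ≡⟨ cong ((e + suc e) C_) (m+n∸m≡n e (suc e)) ⟩
  (e + suc e) C suc e              ∎
  where open ≡-Reasoning

private
  interchange : ∀ a b c d → (a + b) + (c + d) ≡ (a + d) + (b + c)
  interchange = solve-∀
  ballot-index : ∀ e r → suc (e + suc e + r) ≡ e + e + suc (suc r)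
  ballot-index = solve-∀

ballot-formula : ∀ r e {m} → suc m ≡ e + e + r → ballot r e + choosePrev m e ≡ m C e
ballot-formula r       zero    {m} _ = sym (nC0≡1 m)
ballot-formula zero    (suc e) {m} eq
  with refl ← trans (suc-injective eq) (+-identityʳ (e + suc e)) = central-sym e
ballot-formula (suc r) (suc e) {zero} eq = contradiction (sym (suc-injective eq)) (m+1+n≢0 (e + suc e))
ballot-formula (suc r) (suc e) {suc M} eq = begin
  (ballot r (suc e) + ballot (suc (suc r)) e) + suc M C e
    ≡⟨ cong (_ +_) (pascal-prev M e) ⟩
  (ballot r (suc e) + ballot (suc (suc r)) e) + (choosePrev M e + M C e)
    ≡⟨ interchange (ballot r (suc e)) _ _ _ ⟩
  (ballot r (suc e) + M C e) + (ballot (suc (suc r)) e + choosePrev M e)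
    ≡⟨ cong₂ _+_ (ballot-formula r (suc e) eq₁) (ballot-formula (suc (suc r)) e eq₂) ⟩
  M C suc e + M C e
    ≡⟨ +-comm (M C suc e) (M C e) ⟩
  M C e + M C suc e
    ≡⟨ pascal M e ⟨
  suc M C suc e ∎
  where
  open ≡-Reasoning
  M≡ : M ≡ e + suc e + r
  M≡ = suc-injective (trans (suc-injective eq) (+-suc (e + suc e) r))
  eq₁ : suc M ≡ suc e + suc e + r
  eq₁ = cong suc M≡
  eq₂ : suc M ≡ e + e + suc (suc r)
  eq₂ = trans (cong suc M≡) (ballot-index e r)

private
  double-suc : ∀ n → suc (n + suc (n + 0)) ≡ n + suc (suc n)
  double-suc = solve-∀
  double : ∀ n → suc (2 * n) ≡ n + n + 1
  double = solve-∀

central-absorption : ∀ n → n * ((2 * n) C n) ≡ suc n * choosePrev (2 * n) n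
central-absorption zero    = refl
central-absorption (suc n) = begin
  suc n * (suc M C suc n)     ≡⟨ absorption M n ⟩
  suc M * (M C n)             ≡⟨ absorption-sym M n (m≤m+n n (suc (n + 0))) ⟨
  (suc M ∸ n) * (suc M C n)   ≡⟨ cong (λ p → (p ∸ n) * (suc M C n)) (double-suc n) ⟩
  (n + suc (suc n) ∸ n) * (suc M C n)   ≡⟨ cong (_* (suc M C n)) (m+n∸m≡n n (suc (suc n))) ⟩
  suc (suc n) * (suc M C n)   ∎
  where
  open ≡-Reasoning
  M = n + suc (n + 0)

ballot-catalan : ∀ n → ballot 1 n ≡ catalan n
ballot-catalan n = begin
  ballot 1 n                      ≡⟨ m*n/n≡m (ballot 1 n) (suc n) ⟨
  ballot 1 n * suc n / suc n      ≡⟨ cong (_/ suc n) scaled ⟩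
  ((2 * n) C n) / suc n           ∎
  where
  open ≡-Reasoning
  P = choosePrev (2 * n) n
  scaled : ballot 1 n * suc n ≡ (2 * n) C n
  scaled = +-cancelʳ-≡ (suc n * P) _ _ (begin
    ballot 1 n * suc n + suc n * P   ≡⟨ cong (_+ suc n * P) (*-comm (ballot 1 n) (suc n)) ⟩
    suc n * ballot 1 n + suc n * P   ≡⟨ *-distribˡ-+ (suc n) (ballot 1 n) P ⟨
    suc n * (ballot 1 n + P)         ≡⟨ cong (suc n *_) (ballot-formula 1 n (double n)) ⟩
    suc n * ((2 * n) C n)            ≡⟨ cong ((2 * n) C n +_) (central-absorption n) ⟩
    (2 * n) C n + suc n * P          ∎)

leaf : Tree
leaf = node []

length≤sizeL : ∀ ts → length ts ≤ sizeL ts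
length≤sizeL []             = z≤n
length≤sizeL (node cs ∷ ts) = s≤s (≤-trans (length≤sizeL ts) (m≤n+m (sizeL ts) (sizeL cs)))

Forest : ℕ → ℕ → List Tree → Set
Forest r e ts = length ts ≡ r × sizeL ts ≡ r + e

LeafFirst : List Tree → Set
LeafFirst (node [] ∷ _) = ⊤
LeafFirst _             = ⊥

BranchFirst : List Tree → Set
BranchFirst (node (_ ∷ _) ∷ _) = ⊤
BranchFirst _                  = ⊥

-- Inverse of detaching the first subtree of the first tree: it is a
-- bijection from forests of r + 2 trees onto the BranchFirst forests of
-- r + 1 trees with one more node.
attachFirst : List Tree → List Tree
attachFirst (c ∷ node cs ∷ ts) = node (c ∷ cs) ∷ ts
attachFirst _                  = []

private
  regroup : ∀ x y z → suc (x + y) + z ≡ x + (suc y + z)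
  regroup = solve-∀

leaf-first-if-tight : ∀ r ts → Forest (suc r) 0 ts → LeafFirst ts
leaf-first-if-tight r (node []                ∷ ts) _       = tt
leaf-first-if-tight r (node (node ds ∷ cs) ∷ ts) (len , sz) = <-irrefl refl (≤-trans X<r r≤X)
  where
  X = sizeL ds + sizeL cs + sizeL ts
  r≤X : r ≤ X
  r≤X = subst (_≤ X) (suc-injective len) (≤-trans (length≤sizeL ts) (m≤n+m (sizeL ts) _))
  X<r : suc X ≤ r
  X<r = ≤-reflexive (trans (suc-injective sz) (+-identityʳ r))

counted-forests : ∀ r e → Count (Forest r e) (ballot r e)
leaf-first   : ∀ r e → Count (λ ts → Forest (suc r) e ts × LeafFirst ts) (ballot r e)
branch-first : ∀ r e → Count (λ ts → Forest (suc r) (suc e) ts × BranchFirst ts) (ballot (suc (suc r)) e)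

counted-forests zero    zero    =
  count-single [] (refl , refl) λ { [] _ → refl ; (_ ∷ _) (() , _) }
counted-forests zero    (suc e) = count-none λ { [] (_ , ()) ; (_ ∷ _) (() , _) }
counted-forests (suc r) zero    =
  count-resp (λ _ → proj₁) (λ ts f → f , leaf-first-if-tight r ts f) (leaf-first r zero)
counted-forests (suc r) (suc e) =
  count-resp (λ _ → merge) split (count-⊎ disjoint (leaf-first r (suc e)) (branch-first r e))
  where
  merge : ∀ {ts} → (Forest (suc r) (suc e) ts × LeafFirst ts) ⊎ (Forest (suc r) (suc e) ts × BranchFirst ts)
    → Forest (suc r) (suc e) ts
  merge (inj₁ (f , _)) = f
  merge (inj₂ (f , _)) = f
  split : ∀ ts → Forest (suc r) (suc e) ts
    → (Forest (suc r) (suc e) ts × LeafFirst ts) ⊎ (Forest (suc r) (suc e) ts × BranchFirst ts)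
  split (node []      ∷ _) f = inj₁ (f , tt)
  split (node (_ ∷ _) ∷ _) f = inj₂ (f , tt)
  disjoint : ∀ ts → _ × LeafFirst ts → ¬ (_ × BranchFirst ts)
  disjoint (node []      ∷ _) _ (_ , ())
  disjoint (node (_ ∷ _) ∷ _) (_ , ()) _

leaf-first r e = count-bij (leaf ∷_)
  (λ _ (len , sz) → (cong suc len , cong suc sz) , tt)
  (λ { _ _ _ _ refl → refl })
  (λ { (node [] ∷ ts) ((len , sz) , _) → ts , (suc-injective len , suc-injective sz) , refl
     ; (node (_ ∷ _) ∷ _) (_ , ()) })
  (counted-forests r e)

branch-first r e = count-bij attachFirst
  (λ { (c ∷ node cs ∷ ts) (len , sz) →
         (suc-injective len , trans (same-size c cs ts) (trans sz shift)) , tt })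
  (λ { (_ ∷ node _ ∷ _) (_ ∷ node _ ∷ _) _ _ refl → refl
     ; [] _ (() , _) _ _ ; (_ ∷ []) _ (() , _) _ _
     ; (_ ∷ _ ∷ _) [] _ (() , _) _ ; (_ ∷ _ ∷ _) (_ ∷ []) _ (() , _) _ })
  (λ { (node (c ∷ cs) ∷ ts) ((len , sz) , _) →
         (c ∷ node cs ∷ ts) ,
         (cong suc len , trans (sym (same-size c cs ts)) (trans sz (sym shift))) , refl })
  (counted-forests (suc (suc r)) e)
  where
  same-size : ∀ c cs ts → sizeL (attachFirst (c ∷ node cs ∷ ts)) ≡ sizeL (c ∷ node cs ∷ ts)
  same-size c cs ts = regroup (size c) (sizeL cs) (sizeL ts)
  shift : suc (suc r) + e ≡ suc r + suc e
  shift = sym (+-suc (suc r) e)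

firstTree : List Tree → Tree
firstTree (t ∷ _) = t
firstTree []      = leaf

-- T(z) counts plane trees by number of nodes: trees with n + 1 nodes are
-- forests of one tree with 1 + n nodes, counted by ballot 1 n = catalan n.
counted-trees : Counted {Tree} (λ _ → ⊤) size (λ _ → 0) Tser
counted-trees zero    k       = count-none λ { (node _) (_ , () , _) }
counted-trees (suc n) (suc k) = count-none λ { _ (_ , _ , ()) }
counted-trees (suc n) zero    = count-≡ (ballot-catalan n) (count-bij firstTree
  (λ { (t ∷ []) (_ , sz) → tt , trans (sym (+-identityʳ (size t))) sz , refl })
  (λ { (t ∷ []) (u ∷ []) _ _ refl → refl
     ; [] _ (() , _) _ _ ; (_ ∷ _ ∷ _) _ (() , _) _ _
     ; (_ ∷ []) [] _ (() , _) _ ; (_ ∷ []) (_ ∷ _ ∷ _) _ (() , _) _ })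
  (λ t (_ , sz , _) → (t ∷ []) , (refl , trans (+-identityʳ (size t)) sz) , refl)
  (counted-forests 1 n))

kids : Tree → List Tree
kids (node cs) = cs

mutual
  graft : Tree → Tree → Tree
  graft (node [])       s = s
  graft (node (c ∷ cs)) s = node (graftL c cs s)

  graftL : Tree → List Tree → Tree → List Tree
  graftL c []       s = graft c s ∷ []
  graftL c (d ∷ cs) s = c ∷ graftL d cs s

-- Its rightmost leaf is at depth 2; the
-- nodes of a branch deleted by ρ are exactly such a spine minus its root.
spine : Tree × Tree → Tree
spine (x , y) = node (kids x ∷ʳ node (kids y ∷ʳ leaf))

-- The branch rebuilt from its reduction d and the deleted material (x , y).
attach : Tree → Tree × Tree → Tree
attach d p = graft d (spine p)

unsnoc : List Tree → List Tree × Tree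
unsnoc []           = [] , leaf
unsnoc (c ∷ [])     = [] , c
unsnoc (c ∷ d ∷ cs) = map₁ (c ∷_) (unsnoc (d ∷ cs))

spineParts : List Tree → Tree × Tree
spineParts cs = node (proj₁ (unsnoc cs)) , node (proj₁ (unsnoc (kids (proj₂ (unsnoc cs)))))

-- `cutOff c`: the material deleted by `cut c`, as the pair (x , y) with
-- c = attach (cut c) (x , y).  It follows the recursion of `cut`.
mutual
  cutOff : Tree → Tree × Tree
  cutOff (node cs) = cutOffNode (rdepthL cs) cs

  cutOffNode : ℕ → List Tree → Tree × Tree
  cutOffNode 2 cs = spineParts cs
  cutOffNode _ cs = cutOffL cs

  cutOffL : List Tree → Tree × Tree
  cutOffL []           = leaf , leaf
  cutOffL (c ∷ [])     = cutOff c
  cutOffL (c ∷ d ∷ cs) = cutOffL (d ∷ cs)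

rdepthL-∷ʳ : ∀ xs z → rdepthL (xs ∷ʳ z) ≡ suc (rdepth z)
rdepthL-∷ʳ []           z = refl
rdepthL-∷ʳ (a ∷ [])     z = refl
rdepthL-∷ʳ (a ∷ b ∷ xs) z = rdepthL-∷ʳ (b ∷ xs) z

last-rdepth : ∀ xs z {n} → rdepthL (xs ∷ʳ z) ≡ suc n → rdepth z ≡ n
last-rdepth xs z = suc-injective ∘ trans (sym (rdepthL-∷ʳ xs z))

cutL-∷ʳ : ∀ xs z → cutL (xs ∷ʳ z) ≡ xs ∷ʳ cut z
cutL-∷ʳ []           z = refl
cutL-∷ʳ (a ∷ [])     z = refl
cutL-∷ʳ (a ∷ b ∷ xs) z = cong (a ∷_) (cutL-∷ʳ (b ∷ xs) z)

cutOffL-∷ʳ : ∀ xs z → cutOffL (xs ∷ʳ z) ≡ cutOff z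
cutOffL-∷ʳ []           z = refl
cutOffL-∷ʳ (a ∷ [])     z = refl
cutOffL-∷ʳ (a ∷ b ∷ xs) z = cutOffL-∷ʳ (b ∷ xs) z

unsnoc-∷ʳ : ∀ xs z → unsnoc (xs ∷ʳ z) ≡ (xs , z)
unsnoc-∷ʳ []           z = refl
unsnoc-∷ʳ (a ∷ [])     z = refl
unsnoc-∷ʳ (a ∷ b ∷ xs) z = cong (map₁ (a ∷_)) (unsnoc-∷ʳ (b ∷ xs) z)

graft-∷ʳ : ∀ xs z s → graft (node (xs ∷ʳ z)) s ≡ node (xs ∷ʳ graft z s)
graft-∷ʳ []       z s = refl
graft-∷ʳ (a ∷ xs) z s = cong node (graftL-∷ʳ a xs)
  where
  graftL-∷ʳ : ∀ a xs → graftL a (xs ∷ʳ z) s ≡ a ∷ (xs ∷ʳ graft z s)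
  graftL-∷ʳ a []       = refl
  graftL-∷ʳ a (b ∷ xs) = cong (a ∷_) (graftL-∷ʳ b xs)

cutNode-other : ∀ n cs → n ≢ 2 → cutNode n cs ≡ cutL cs
cutNode-other 0                   cs _  = refl
cutNode-other 1                   cs _  = refl
cutNode-other 2                   cs n≢2 = contradiction refl n≢2
cutNode-other (suc (suc (suc n))) cs _  = refl

cutOffNode-other : ∀ n cs → n ≢ 2 → cutOffNode n cs ≡ cutOffL cs
cutOffNode-other 0                   cs _  = refl
cutOffNode-other 1                   cs _  = refl
cutOffNode-other 2                   cs n≢2 = contradiction refl n≢2
cutOffNode-other (suc (suc (suc n))) cs _  = refl

rdepth≡0⇒leaf : ∀ t → rdepth t ≡ 0 → t ≡ leaf
rdepth≡0⇒leaf (node cs) r≡0 with initLast cs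
... | []       = refl
... | xs ∷ʳ′ z = contradiction (trans (sym (rdepthL-∷ʳ xs z)) r≡0) λ ()

cutNode-2 : ∀ {n} cs → n ≡ 2 → cutNode n cs ≡ []
cutNode-2 cs refl = refl

cutOffNode-2 : ∀ {n} cs → n ≡ 2 → cutOffNode n cs ≡ spineParts cs
cutOffNode-2 cs refl = refl

rdepthL-nonempty : ∀ c cs → rdepthL (c ∷ cs) ≢ 0
rdepthL-nonempty c []       ()
rdepthL-nonempty c (d ∷ cs) = rdepthL-nonempty d cs

∷ʳ-not-2 : ∀ xs z → rdepth z ≢ 1 → rdepthL (xs ∷ʳ z) ≢ 2
∷ʳ-not-2 xs z z≢1 = z≢1 ∘ last-rdepth xs z

cut-∷ʳ : ∀ xs z → rdepth z ≢ 1 → cut (node (xs ∷ʳ z)) ≡ node (xs ∷ʳ cut z)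
cut-∷ʳ xs z z≢1 = cong node (trans (cutNode-other _ _ (∷ʳ-not-2 xs z z≢1)) (cutL-∷ʳ xs z))

cutOff-∷ʳ : ∀ xs z → rdepth z ≢ 1 → cutOff (node (xs ∷ʳ z)) ≡ cutOff z
cutOff-∷ʳ xs z z≢1 = trans (cutOffNode-other _ _ (∷ʳ-not-2 xs z z≢1)) (cutOffL-∷ʳ xs z)

rdepth-spine : ∀ p → rdepth (spine p) ≡ 2
rdepth-spine (x , y) = trans (rdepthL-∷ʳ (kids x) _) (cong suc (rdepthL-∷ʳ (kids y) leaf))

cut-spine : ∀ p → cut (spine p) ≡ leaf
cut-spine p = cong node (cutNode-2 _ (rdepth-spine p))

cutOff-spine : ∀ p → cutOff (spine p) ≡ p
cutOff-spine (node xs , node ys) = trans (cutOffNode-2 _ (rdepth-spine (node xs , node ys))) parts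
  where
  parts : spineParts (xs ∷ʳ node (ys ∷ʳ leaf)) ≡ (node xs , node ys)
  parts rewrite unsnoc-∷ʳ xs (node (ys ∷ʳ leaf)) | unsnoc-∷ʳ ys leaf = refl

mutual
  rdepth-graft : ∀ e s → rdepth (graft e s) ≡ rdepth e + rdepth s
  rdepth-graft (node [])       s = refl
  rdepth-graft (node (c ∷ cs)) s = rdepth-graftL c cs s

  rdepth-graftL : ∀ c cs s → rdepthL (graftL c cs s) ≡ rdepthL (c ∷ cs) + rdepth s
  rdepth-graftL c []           s = cong suc (rdepth-graft c s)
  rdepth-graftL c (d ∷ [])     s = rdepth-graftL d [] s
  rdepth-graftL c (d ∷ e ∷ cs) s = rdepth-graftL d (e ∷ cs) s

graftL-not-2 : ∀ c cs s → rdepth s ≡ 2 → rdepthL (graftL c cs s) ≢ 2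
graftL-not-2 c cs s r≡2 eq = rdepthL-nonempty c cs (+-cancelʳ-≡ 2 _ 0 (begin
  rdepthL (c ∷ cs) + 2           ≡⟨ cong (rdepthL (c ∷ cs) +_) r≡2 ⟨
  rdepthL (c ∷ cs) + rdepth s    ≡⟨ rdepth-graftL c cs s ⟨
  rdepthL (graftL c cs s)        ≡⟨ eq ⟩
  2                              ∎))
  where open ≡-Reasoning

mutual
  cut-graft : ∀ e s → rdepth s ≡ 2 → cut (graft e s) ≡ e
  cut-graft (node [])       (node ds) r≡2 = cong node (cutNode-2 ds r≡2)
  cut-graft (node (c ∷ cs)) s         r≡2 =
    cong node (trans (cutNode-other _ _ (graftL-not-2 c cs s r≡2)) (cut-graftL c cs s r≡2))

  cut-graftL : ∀ c cs s → rdepth s ≡ 2 → cutL (graftL c cs s) ≡ c ∷ cs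
  cut-graftL c []           s r≡2 = cong (_∷ []) (cut-graft c s r≡2)
  cut-graftL c (d ∷ [])     s r≡2 = cong (c ∷_) (cut-graftL d [] s r≡2)
  cut-graftL c (d ∷ e ∷ cs) s r≡2 = cong (c ∷_) (cut-graftL d (e ∷ cs) s r≡2)

mutual
  cutOff-graft : ∀ e s → rdepth s ≡ 2 → cutOff (graft e s) ≡ cutOff s
  cutOff-graft (node [])       s r≡2 = refl
  cutOff-graft (node (c ∷ cs)) s r≡2 =
    trans (cutOffNode-other _ _ (graftL-not-2 c cs s r≡2)) (cutOff-graftL c cs s r≡2)

  cutOff-graftL : ∀ c cs s → rdepth s ≡ 2 → cutOffL (graftL c cs s) ≡ cutOff s
  cutOff-graftL c []           s r≡2 = cutOff-graft c s r≡2
  cutOff-graftL c (d ∷ [])     s r≡2 = cutOff-graftL d [] s r≡2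
  cutOff-graftL c (d ∷ e ∷ cs) s r≡2 = cutOff-graftL d (e ∷ cs) s r≡2

rdepth-attach : ∀ d p → rdepth (attach d p) ≡ suc (suc (rdepth d))
rdepth-attach d p = begin
  rdepth (graft d (spine p))    ≡⟨ rdepth-graft d (spine p) ⟩
  rdepth d + rdepth (spine p)   ≡⟨ cong (rdepth d +_) (rdepth-spine p) ⟩
  rdepth d + 2                  ≡⟨ +-comm (rdepth d) 2 ⟩
  suc (suc (rdepth d))          ∎
  where open ≡-Reasoning

cut-attach : ∀ d p → cut (attach d p) ≡ d
cut-attach d p = cut-graft d (spine p) (rdepth-spine p)

cutOff-attach : ∀ d p → cutOff (attach d p) ≡ p
cutOff-attach d p = trans (cutOff-graft d (spine p) (rdepth-spine p)) (cutOff-spine p)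

decompose : ∀ k c → rdepth c ≡ suc (suc k) → attach (cut c) (cutOff c) ≡ c
decompose k (node cs) r≡ with initLast cs
... | [] = contradiction r≡ λ ()
decompose zero (node .(xs ∷ʳ node zs)) r≡ | xs ∷ʳ′ node zs with initLast zs
... | [] = contradiction (last-rdepth xs leaf r≡) λ ()
... | ys ∷ʳ′ w with refl ← rdepth≡0⇒leaf w (last-rdepth ys w (last-rdepth xs _ r≡))
  = cong₂ attach (cut-spine p) (cutOff-spine p)
  where p = (node xs , node ys)
decompose (suc k) (node .(xs ∷ʳ z)) r≡ | xs ∷ʳ′ z = begin
  attach (cut (node (xs ∷ʳ z))) (cutOff (node (xs ∷ʳ z)))
    ≡⟨ cong₂ attach (cut-∷ʳ xs z z≢1) (cutOff-∷ʳ xs z z≢1) ⟩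
  attach (node (xs ∷ʳ cut z)) (cutOff z)
    ≡⟨ graft-∷ʳ xs (cut z) _ ⟩
  node (xs ∷ʳ attach (cut z) (cutOff z))
    ≡⟨ cong (λ t → node (xs ∷ʳ t)) (decompose k z z≡) ⟩
  node (xs ∷ʳ z) ∎
  where
  open ≡-Reasoning
  z≡ : rdepth z ≡ suc (suc k)
  z≡ = last-rdepth xs z r≡
  z≢1 : rdepth z ≢ 1
  z≢1 e = contradiction (trans (sym z≡) e) λ ()

sizeL-++ : ∀ xs ys → sizeL (xs ++ ys) ≡ sizeL xs + sizeL ys
sizeL-++ []       ys = refl
sizeL-++ (x ∷ xs) ys =
  trans (cong (size x +_) (sizeL-++ xs ys)) (sym (+-assoc (size x) (sizeL xs) (sizeL ys)))

private
  spine-count : ∀ a b → suc (a + (suc (b + (1 + 0)) + 0)) ≡ suc a + suc b + 1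
  spine-count = solve-∀

size-spine : ∀ p → size (spine p) ≡ size (proj₁ p) + size (proj₂ p) + 1
size-spine (node xs , node ys) = begin
  suc (sizeL (xs ∷ʳ node (ys ∷ʳ leaf)))
    ≡⟨ cong suc (sizeL-++ xs _) ⟩
  suc (sizeL xs + (suc (sizeL (ys ∷ʳ leaf)) + 0))
    ≡⟨ cong (λ m → suc (sizeL xs + (suc m + 0))) (sizeL-++ ys _) ⟩
  suc (sizeL xs + (suc (sizeL ys + (1 + 0)) + 0))
    ≡⟨ spine-count (sizeL xs) (sizeL ys) ⟩
  suc (sizeL xs) + suc (sizeL ys) + 1 ∎
  where open ≡-Reasoning

-- Grafting identifies the rightmost leaf of e with the root of s.
mutual
  size-graft : ∀ e s → size (graft e s) + 1 ≡ size e + size s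
  size-graft (node [])       s = +-comm (size s) 1
  size-graft (node (c ∷ cs)) s = cong suc (size-graftL c cs s)

  size-graftL : ∀ c cs s → sizeL (graftL c cs s) + 1 ≡ sizeL (c ∷ cs) + size s
  size-graftL c []       s = begin
    size (graft c s) + 0 + 1   ≡⟨ cong (_+ 1) (+-identityʳ _) ⟩
    size (graft c s) + 1       ≡⟨ size-graft c s ⟩
    size c + size s            ≡⟨ cong (_+ size s) (+-identityʳ (size c)) ⟨
    size c + 0 + size s        ∎
    where open ≡-Reasoning
  size-graftL c (d ∷ cs) s = begin
    size c + sizeL (graftL d cs s) + 1     ≡⟨ +-assoc (size c) _ 1 ⟩
    size c + (sizeL (graftL d cs s) + 1)   ≡⟨ cong (size c +_) (size-graftL d cs s) ⟩
    size c + (sizeL (d ∷ cs) + size s)     ≡⟨ +-assoc (size c) _ (size s) ⟨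
    size c + sizeL (d ∷ cs) + size s       ∎
    where open ≡-Reasoning

size-attach : ∀ d p → size (attach d p) ≡ size d + (size (proj₁ p) + size (proj₂ p))
size-attach d p = +-cancelʳ-≡ 1 _ _ (begin
  size (attach d p) + 1                          ≡⟨ size-graft d (spine p) ⟩
  size d + size (spine p)                        ≡⟨ cong (size d +_) (size-spine p) ⟩
  size d + (size (proj₁ p) + size (proj₂ p) + 1) ≡⟨ +-assoc (size d) _ 1 ⟨
  size d + (size (proj₁ p) + size (proj₂ p)) + 1 ∎)
  where open ≡-Reasoning

-- A block describes one non-leaf branch of a preimage beyond its reduction:
-- the material (x , y) deleted by ρ and the number r (its gap) of leaf
-- children of the root immediately to the right of the branch.  The shape of
-- the type is that of the product t · 1/(1-t) · T · T.
Block : Set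
Block = ((⊤ × ℕ) × Tree) × Tree

mkBlock : ℕ → Tree × Tree → Block
mkBlock r (x , y) = ((tt , r) , x) , y

gap : Block → ℕ
gap (((_ , r) , _) , _) = r

deleted : Block → Tree × Tree
deleted ((_ , x) , y) = x , y

-- z marks the deleted nodes, t the branch's rightmost leaf and the gap.
blockZ : Block → ℕ
blockZ u = size (proj₁ (deleted u)) + size (proj₂ (deleted u))

blockT : Block → ℕ
blockT u = suc (gap u)

blocksZ blocksT : List Block → ℕ
blocksZ us = sum (map blockZ us)
blocksT us = sum (map blockT us)

counted-blocks : Counted {Block} (λ _ → ⊤) blockZ blockT uSer
counted-blocks = counted-resp (λ _ _ → tt) (λ _ _ → ((tt , tt) , tt) , tt) (λ _ → refl)
  (λ u → trans (+-identityʳ _) (+-identityʳ (suc (gap u))))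
  (counted-⊛ (counted-⊛ (counted-⊛ counted-t counted-geom) counted-trees) counted-trees)

leaves : ℕ → List Tree
leaves r = replicate r leaf

blocks : List Tree → List Block → List Tree
blocks (d ∷ ds) (u ∷ us) = attach d (deleted u) ∷ (leaves (gap u) ++ blocks ds us)
blocks _        _        = []

Parse : Set
Parse = ℕ × (List Tree × List Block)

branchesOf : Parse → List Tree
branchesOf (_ , ds , _) = ds

blocksOf : Parse → List Block
blocksOf (_ , _ , us) = us

rebuild : Parse → List Tree
rebuild (j , ds , us) = leaves j ++ blocks ds us

Skeleton : Set
Skeleton = ℕ × (Tree × List Block)

assemble : Skeleton → Tree
assemble (j , σ , us) = node (rebuild (j , kids σ , us))

-- Parsing root children from the right, mirroring `rhoL`: a leaf is counted
-- into the current gap, any other branch c contributes `cut c` and a block.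
parseStep : ℕ → Tree → Parse → Parse
parseStep zero    c (j , ds , us) = suc j , ds , us
parseStep (suc _) c (j , ds , us) = 0 , cut c ∷ ds , mkBlock j (cutOff c) ∷ us

parseChildren : List Tree → Parse
parseChildren []       = 0 , [] , []
parseChildren (c ∷ cs) = parseStep (rdepth c) c (parseChildren cs)

parse : Tree → Skeleton
parse (node cs) = let (j , ds , us) = parseChildren cs in j , node ds , us

rhoL-parse : ∀ cs → rhoL cs ≡ branchesOf (parseChildren cs)
rhoL-parse []       = refl
rhoL-parse (c ∷ cs) with rdepth c
... | zero  = rhoL-parse cs
... | suc _ = cong (cut c ∷_) (rhoL-parse cs)

length-parse : ∀ cs → length (blocksOf (parseChildren cs)) ≡ length (branchesOf (parseChildren cs))
length-parse []       = refl
length-parse (c ∷ cs) with rdepth c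
... | zero  = length-parse cs
... | suc _ = cong suc (length-parse cs)

parse-rebuild : ∀ j ds us → length us ≡ length ds → parseChildren (rebuild (j , ds , us)) ≡ (j , ds , us)
parse-rebuild (suc j) ds us len rewrite parse-rebuild j ds us len = refl
parse-rebuild zero []       []       _   = refl
parse-rebuild zero (d ∷ ds) (u ∷ us) len
  rewrite rdepth-attach d (deleted u) | parse-rebuild (gap u) ds us (suc-injective len)
        | cut-attach d (deleted u) | cutOff-attach d (deleted u) = refl

OddBranch : Tree → Set
OddBranch c = Odd (suc (rdepth c))

-- Rebuilding inverts parsing on Catalan--Stanley root children: there every
-- branch is a leaf or has rdepth at least 2.
rebuild-parse : ∀ cs → All OddBranch cs → rebuild (parseChildren cs) ≡ cs
rebuild-parse []       []         = refl
rebuild-parse (c ∷ cs) (oc ∷ ocs) with rdepth c in eq | rebuild-parse cs ocs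
... | zero        | ih = cong₂ _∷_ (sym (rdepth≡0⇒leaf c eq)) ih
... | suc (suc k) | ih = cong₂ _∷_ (decompose k c eq) ih
rebuild-parse (c ∷ cs) (odd-ss () ∷ _) | suc zero | _

leaves-odd : ∀ r → All OddBranch (leaves r)
leaves-odd zero    = []
leaves-odd (suc r) = odd-one ∷ leaves-odd r

blocks-odd : ∀ ds us → All OddBranch ds → All OddBranch (blocks ds us)
blocks-odd (d ∷ ds) (u ∷ us) (od ∷ ods) =
  subst (Odd ∘ suc) (sym (rdepth-attach d (deleted u))) (odd-ss od)
  ∷ ++⁺ (leaves-odd (gap u)) (blocks-odd ds us ods)
blocks-odd []       _        _ = []
blocks-odd (_ ∷ _)  []       _ = []

sizeL-leaves : ∀ r → sizeL (leaves r) ≡ r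
sizeL-leaves zero    = refl
sizeL-leaves (suc r) = cong suc (sizeL-leaves r)

-- Each block contributes its branch, the rightmost leaf of which is marked
-- by t, and its gap of leaves.
length-blocks : ∀ ds us → length us ≡ length ds → length (blocks ds us) ≡ blocksT us
length-blocks []       []       _   = refl
length-blocks (d ∷ ds) (u ∷ us) len = cong suc (begin
  length (leaves (gap u) ++ blocks ds us)
    ≡⟨ length-++ (leaves (gap u)) ⟩
  length (leaves (gap u)) + length (blocks ds us)
    ≡⟨ cong₂ _+_ (length-replicate (gap u)) (length-blocks ds us (suc-injective len)) ⟩
  gap u + blocksT us ∎)
  where open ≡-Reasoning

private
  regroup-block : ∀ D W r B L → D + W + (r + B) + suc L ≡ D + W + suc r + (B + L)
  regroup-block = solve-∀
  regroup-weights : ∀ D W r S Z T → D + W + suc r + (S + (Z + T)) ≡ D + S + (W + Z + (suc r + T))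
  regroup-weights = solve-∀

sizeL-blocks : ∀ ds us → length us ≡ length ds
  → sizeL (blocks ds us) + length ds ≡ sizeL ds + (blocksZ us + blocksT us)
sizeL-blocks []       []       _   = refl
sizeL-blocks (d ∷ ds) (u ∷ us) len = begin
  size (attach d p) + sizeL (leaves r ++ blocks ds us) + suc (length ds)
    ≡⟨ cong₂ (λ m m′ → m + m′ + suc (length ds)) (size-attach d p)
             (trans (sizeL-++ (leaves r) _) (cong (_+ sizeL (blocks ds us)) (sizeL-leaves r))) ⟩
  size d + blockZ u + (r + sizeL (blocks ds us)) + suc (length ds)
    ≡⟨ regroup-block (size d) (blockZ u) r _ _ ⟩
  size d + blockZ u + suc r + (sizeL (blocks ds us) + length ds)
    ≡⟨ cong (size d + blockZ u + suc r +_) (sizeL-blocks ds us (suc-injective len)) ⟩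
  size d + blockZ u + suc r + (sizeL ds + (blocksZ us + blocksT us))
    ≡⟨ regroup-weights (size d) (blockZ u) r (sizeL ds) _ _ ⟩
  size d + sizeL ds + (blockZ u + blocksZ us + (suc r + blocksT us)) ∎
  where
  open ≡-Reasoning
  p = deleted u
  r = gap u

WellFormed : Skeleton → Set
WellFormed (_ , σ , us) = length us ≡ b σ

skeletonZ skeletonT : Skeleton → ℕ
skeletonZ (_ , σ , us) = a σ + blocksZ us
skeletonT (j , _ , us) = j + blocksT us

b-assemble : ∀ s → WellFormed s → b (assemble s) ≡ skeletonT s
b-assemble (j , node ds , us) wf =
  trans (length-++ (leaves j)) (cong₂ _+_ (length-replicate j) (length-blocks ds us wf))

private
  regroup-size₁ : ∀ A Z j T L → A + Z + (j + T) + L ≡ A + L + Z + j + T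
  regroup-size₁ = solve-∀
  regroup-size₂ : ∀ S Z j T → suc S + Z + j + T ≡ suc (j + (S + (Z + T)))
  regroup-size₂ = solve-∀

-- Total size, proved after adding the number of children of σ to both
-- sides, which turns a σ into 1 + (size of the forest of σ).
size-assemble : ∀ s → WellFormed s → size (assemble s) ≡ skeletonZ s + skeletonT s
size-assemble (j , node ds , us) wf = +-cancelʳ-≡ L _ _ (begin
  size (node (leaves j ++ B)) + L        ≡⟨ cong (λ m → suc m + L) (sizeL-++ (leaves j) B) ⟩
  suc (sizeL (leaves j) + sizeL B) + L   ≡⟨ cong (λ m → suc (m + sizeL B) + L) (sizeL-leaves j) ⟩
  suc (j + sizeL B + L)                  ≡⟨ cong suc (+-assoc j (sizeL B) L) ⟩
  suc (j + (sizeL B + L))                ≡⟨ cong (λ m → suc (j + m)) (sizeL-blocks ds us wf) ⟩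
  suc (j + (S + (Z + T)))                ≡⟨ regroup-size₂ S Z j T ⟨
  suc S + Z + j + T                      ≡⟨ cong (λ m → m + Z + j + T) (m∸n+n≡m L≤size) ⟨
  A + L + Z + j + T                      ≡⟨ regroup-size₁ A Z j T L ⟨
  A + Z + (j + T) + L                    ∎)
  where
  open ≡-Reasoning
  B = blocks ds us
  L = length ds
  S = sizeL ds
  Z = blocksZ us
  T = blocksT us
  A = a (node ds)
  L≤size : L ≤ suc S
  L≤size = m≤n⇒m≤1+n (length≤sizeL ds)

a-assemble : ∀ s → WellFormed s → a (assemble s) ≡ skeletonZ s
a-assemble s wf = begin
  size (assemble s) ∸ b (assemble s)          ≡⟨ cong₂ _∸_ (size-assemble s wf) (b-assemble s wf) ⟩
  skeletonZ s + skeletonT s ∸ skeletonT s     ≡⟨ m+n∸n≡m (skeletonZ s) (skeletonT s) ⟩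
  skeletonZ s                                 ∎
  where open ≡-Reasoning

reduced : Skeleton → Tree
reduced (_ , σ , _) = σ

parse-assemble : ∀ s → WellFormed s → parse (assemble s) ≡ s
parse-assemble (j , node ds , us) wf rewrite parse-rebuild j ds us wf = refl

assemble-parse : ∀ τ → IsCS τ → assemble (parse τ) ≡ τ
assemble-parse (node cs) odd = cong node (rebuild-parse cs odd)

wellFormed-parse : ∀ τ → WellFormed (parse τ)
wellFormed-parse (node cs) = length-parse cs

ρ-parse : ∀ τ → ρ τ ≡ reduced (parse τ)
ρ-parse (node cs) = cong node (rhoL-parse cs)

ρ-assemble : ∀ s → WellFormed s → ρ (assemble s) ≡ reduced s
ρ-assemble s wf = trans (ρ-parse (assemble s)) (cong reduced (parse-assemble s wf))

assemble-CS : ∀ s → IsCS (reduced s) → IsCS (assemble s)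
assemble-CS (j , node ds , us) odd = ++⁺ (leaves-odd j) (blocks-odd ds us odd)

-- Φ f = 1/(1-t) · f(z, u) counts the well-formed skeletons with reduced tree
-- in F: the leading leaves, then the reduced tree with one block per child.
counted-skeletons : {F : Tree → Set} {f : Series2} → Counted F a b f
  → Counted (λ s → F (reduced s) × WellFormed s) skeletonZ skeletonT (Φ f)
counted-skeletons cf = counted-resp
  (λ _ (_ , fσ , _ , wf) → fσ , wf) (λ (_ , _ , us) (fσ , wf) → tt , fσ , universal (λ _ → tt) us , wf)
  (λ _ → refl) (λ _ → refl)
  (counted-⊛ counted-geom (counted-substT cf counted-blocks (λ _ _ → s≤s z≤n)))

mainTheorem2 : (F : Tree → Set) → (∀ τ → F τ → IsCS τ) → (f : Series2)
    → (∀ n k → HasCount (λ τ → F τ × a τ ≡ n × b τ ≡ k) (f n k))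
    → ∀ n k → HasCount (λ τ → (IsCS τ × F (ρ τ)) × a τ ≡ n × b τ ≡ k) (Φ f n k)
mainTheorem2 F F⊆S f cf = counted-bij assemble into injective onto (counted-skeletons cf)
  where
  into : ∀ s → F (reduced s) × WellFormed s
    → (IsCS (assemble s) × F (ρ (assemble s))) × a (assemble s) ≡ skeletonZ s × b (assemble s) ≡ skeletonT s
  into s (fσ , wf) =
    (assemble-CS s (F⊆S (reduced s) fσ) , subst F (sym (ρ-assemble s wf)) fσ) ,
    a-assemble s wf , b-assemble s wf
  injective : ∀ s s′ → F (reduced s) × WellFormed s → F (reduced s′) × WellFormed s′
    → assemble s ≡ assemble s′ → s ≡ s′
  injective s s′ (_ , wf) (_ , wf′) eq =
    trans (sym (parse-assemble s wf)) (trans (cong parse eq) (parse-assemble s′ wf′))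
  onto : ∀ τ → IsCS τ × F (ρ τ) → Σ Skeleton λ s → (F (reduced s) × WellFormed s) × assemble s ≡ τ
  onto τ (cs , fρ) = parse τ , (subst F (ρ-parse τ) fρ , wellFormed-parse τ) , assemble-parse τ cs
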